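{- There exist a graded Kleene algebra with tests $(K,T,+,;,{}^*,\rightarrow,0,1)$ and elements $b\in T$, $p\in K$ such that the equivalence $b;p=p;b\Leftrightarrow (b\rightarrow0);p=p;(b\rightarrow0)$ fails (i.e. exactly one of the two equations holds).
   Context: A graded Kleene algebra with tests (GKAT) is a tuple $(K,T,+,;,{}^*,\rightarrow,0,1)$ where $K$ is a set, $T\subseteq K$, $0,1\in T$, $+$ and $;$ are binary operations on $K$ under which $T$ is closed, ${}^*$ is unary on $K$, and $\rightarrow$ is a binary operation on $T$ with values in $T$, such that for all $p,q,r\in K$ and $a,b,c\in T$: $p+(q+r)=(p+q)+r$; $p+q=q+p$; $p;(q;r)=(p;q);r$; $p;1=1;p=p$; $p;(q+r)=p;q+p;r$; $(p+q);r=p;r+q;r$; $p;0=0;p=0$; $1+p;p^*=p^*$; $q+p;r\leq r\Rightarrow p^*;q\leq r$; $q+r;p\leq r\Rightarrow q;p^*\leq r$; $a;b\leq c\Leftrightarrow b\leq a\rightarrow c$; $a\leq 1$; $a;b=b;a$, where $p\leq q$ means $p+q=q$. -}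

module Defs where

open import Relation.Binary.PropositionalEquality using (_≡_)
open import Data.Product using (Σ; _×_)

record GKAT : Set₁ where
  infixl 6 _+_
  infixl 7 _⨾_
  field
    K     : Set
    T     : K → Set
    _+_   : K → K → K
    _⨾_   : K → K → K
    _⋆    : K → K
    imp   : (a b : K) → T a → T b → K
    𝟘 𝟙   : K
    T-𝟘   : T 𝟘
    T-𝟙   : T 𝟙
    T-+   : ∀ {a b} → T a → T b → T (a + b)
    T-⨾   : ∀ {a b} → T a → T b → T (a ⨾ b)
    T-imp : ∀ {a b} (ta : T a) (tb : T b) → T (imp a b ta tb)

  infix 4 _≤_
  _≤_ : K → K → Set
  p ≤ q = p + q ≡ q

  field
    +-assoc   : ∀ p q r → p + (q + r) ≡ (p + q) + r
    +-comm    : ∀ p q → p + q ≡ q + p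
    ⨾-assoc   : ∀ p q r → p ⨾ (q ⨾ r) ≡ (p ⨾ q) ⨾ r
    ⨾-identʳ  : ∀ p → p ⨾ 𝟙 ≡ p
    ⨾-identˡ  : ∀ p → 𝟙 ⨾ p ≡ p
    distribˡ  : ∀ p q r → p ⨾ (q + r) ≡ p ⨾ q + p ⨾ r
    distribʳ  : ∀ p q r → (p + q) ⨾ r ≡ p ⨾ r + q ⨾ r
    zeroʳ     : ∀ p → p ⨾ 𝟘 ≡ 𝟘
    zeroˡ     : ∀ p → 𝟘 ⨾ p ≡ 𝟘
    star-unfold : ∀ p → 𝟙 + p ⨾ (p ⋆) ≡ p ⋆
    star-indˡ : ∀ p q r → q + p ⨾ r ≤ r → (p ⋆) ⨾ q ≤ r
    star-indʳ : ∀ p q r → q + r ⨾ p ≤ r → q ⨾ (p ⋆) ≤ r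
    residual-to   : ∀ {a b c} (ta : T a) (tb : T b) (tc : T c) →
                    a ⨾ b ≤ c → b ≤ imp a c ta tc
    residual-from : ∀ {a b c} (ta : T a) (tb : T b) (tc : T c) →
                    b ≤ imp a c ta tc → a ⨾ b ≤ c
    test-≤𝟙   : ∀ {a} → T a → a ≤ 𝟙
    test-comm : ∀ {a b} → T a → T b → a ⨾ b ≡ b ⨾ a

-- The counterexample lives in the algebra of upper triangular 2×2 Boolean
-- matrices, whose tests are the chain 0 < e₁₁ < 1 with Heyting implication.
-- There e₁₁ ⇒ 0 = 0, so the second equation holds for every p, while the
-- matrix units e₁₁ and e₁₂ do not commute.
module Submission where

open import Defs
open import Data.Bool using (Bool; true; false; _∧_; _∨_; if_then_else_)
import Data.Bool.Properties as Bool
open import Data.Product using (Σ; _×_; _,_)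
open import Data.Product.Properties using (≡-dec)
open import Data.Sum using (_⊎_; inj₁; inj₂)
open import Relation.Binary.Definitions using (DecidableEquality)
open import Relation.Binary.PropositionalEquality using (_≡_; _≢_; refl)
open import Relation.Nullary using (¬_; Dec; does; _×-dec_; _⊎-dec_; _→-dec_)
open import Relation.Nullary.Decidable using (map′; from-yes)
open import Relation.Unary using (Decidable)

Exhaustible : Set → Set₁
Exhaustible A = {P : A → Set} → Decidable P → Dec (∀ x → P x)

Bool-exhaustible : Exhaustible Bool
Bool-exhaustible P? = map′ both (λ h → h true , h false) (P? true ×-dec P? false)
  where
  both : ∀ {P : Bool → Set} → P true × P false → ∀ x → P x
  both (t , f) true  = t
  both (t , f) false = f

×-exhaustible : {A B : Set} → Exhaustible A → Exhaustible B → Exhaustible (A × B)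
×-exhaustible ∀A? ∀B? P? =
  map′ (λ h (a , b) → h a b) (λ h a b → h (a , b)) (∀A? λ a → ∀B? λ b → P? (a , b))

-- (a , b , d) stands for the matrix [[a , b] , [0 , d]].
UT : Set
UT = Bool × Bool × Bool

∀? : Exhaustible UT
∀? = ×-exhaustible Bool-exhaustible (×-exhaustible Bool-exhaustible Bool-exhaustible)

_≟_ : DecidableEquality UT
_≟_ = ≡-dec Bool._≟_ (≡-dec Bool._≟_ Bool._≟_)

infix  4 _≟_
infixr 8 _⇒_
infixl 6 _⊕_
infixl 7 _⊗_
infix  9 _✶

_⊕_ : UT → UT → UT
(a , b , d) ⊕ (a′ , b′ , d′) = a ∨ a′ , b ∨ b′ , d ∨ d′

_⊗_ : UT → UT → UT
(a , b , d) ⊗ (a′ , b′ , d′) = a ∧ a′ , a ∧ b′ ∨ b ∧ d′ , d ∧ d′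

-- The star of [[a , b] , [0 , d]] is [[a* , a* b d*] , [0 , d*]], and a* = d* = 1.
_✶ : UT → UT
(a , b , d) ✶ = true , b , true

𝟎 𝟏 e₁₁ e₁₂ : UT
𝟎   = false , false , false
𝟏   = true  , false , true
e₁₁ = true  , false , false
e₁₂ = false , true  , false

IsTest : UT → Set
IsTest x = x ≡ 𝟎 ⊎ x ≡ e₁₁ ⊎ x ≡ 𝟏

isTest? : Decidable IsTest
isTest? x = x ≟ 𝟎 ⊎-dec x ≟ e₁₁ ⊎-dec x ≟ 𝟏

-- Heyting implication of the chain of tests; its values off the tests are junk.
_⇒_ : UT → UT → UT
x ⇒ y = if does (x ⊕ y ≟ y) then 𝟏 else y

upperTriangular : GKAT
upperTriangular = record
  { K = UT ; T = IsTest ; _+_ = _⊕_ ; _⨾_ = _⊗_ ; _⋆ = _✶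
  ; imp = λ x y _ _ → x ⇒ y ; 𝟘 = 𝟎 ; 𝟙 = 𝟏
  ; T-𝟘 = inj₁ refl
  ; T-𝟙 = inj₂ (inj₂ refl)
  ; T-+ = λ {x} {y} → from-yes (∀? λ x → ∀? λ y →
      isTest? x →-dec isTest? y →-dec isTest? (x ⊕ y)) x y
  ; T-⨾ = λ {x} {y} → from-yes (∀? λ x → ∀? λ y →
      isTest? x →-dec isTest? y →-dec isTest? (x ⊗ y)) x y
  ; T-imp = λ {x} {y} → from-yes (∀? λ x → ∀? λ y →
      isTest? x →-dec isTest? y →-dec isTest? (x ⇒ y)) x y
  ; +-assoc = from-yes (∀? λ x → ∀? λ y → ∀? λ z → x ⊕ (y ⊕ z) ≟ (x ⊕ y) ⊕ z)
  ; +-comm = from-yes (∀? λ x → ∀? λ y → x ⊕ y ≟ y ⊕ x)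
  ; ⨾-assoc = from-yes (∀? λ x → ∀? λ y → ∀? λ z → x ⊗ (y ⊗ z) ≟ (x ⊗ y) ⊗ z)
  ; ⨾-identʳ = from-yes (∀? λ x → x ⊗ 𝟏 ≟ x)
  ; ⨾-identˡ = from-yes (∀? λ x → 𝟏 ⊗ x ≟ x)
  ; distribˡ = from-yes (∀? λ x → ∀? λ y → ∀? λ z → x ⊗ (y ⊕ z) ≟ x ⊗ y ⊕ x ⊗ z)
  ; distribʳ = from-yes (∀? λ x → ∀? λ y → ∀? λ z → (x ⊕ y) ⊗ z ≟ x ⊗ z ⊕ y ⊗ z)
  ; zeroʳ = from-yes (∀? λ x → x ⊗ 𝟎 ≟ 𝟎)
  ; zeroˡ = from-yes (∀? λ x → 𝟎 ⊗ x ≟ 𝟎)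
  ; star-unfold = from-yes (∀? λ x → 𝟏 ⊕ x ⊗ x ✶ ≟ x ✶)
  ; star-indˡ = from-yes (∀? λ x → ∀? λ y → ∀? λ z →
      y ⊕ x ⊗ z ⊕ z ≟ z →-dec x ✶ ⊗ y ⊕ z ≟ z)
  ; star-indʳ = from-yes (∀? λ x → ∀? λ y → ∀? λ z →
      y ⊕ z ⊗ x ⊕ z ≟ z →-dec y ⊗ x ✶ ⊕ z ≟ z)
  ; residual-to = λ {x} {y} {z} → from-yes (∀? λ x → ∀? λ y → ∀? λ z →
      isTest? x →-dec isTest? y →-dec isTest? z →-dec
      x ⊗ y ⊕ z ≟ z →-dec y ⊕ x ⇒ z ≟ x ⇒ z) x y z
  ; residual-from = λ {x} {y} {z} → from-yes (∀? λ x → ∀? λ y → ∀? λ z →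
      isTest? x →-dec isTest? y →-dec isTest? z →-dec
      y ⊕ x ⇒ z ≟ x ⇒ z →-dec x ⊗ y ⊕ z ≟ z) x y z
  ; test-≤𝟙 = λ {x} → from-yes (∀? λ x → isTest? x →-dec x ⊕ 𝟏 ≟ 𝟏) x
  ; test-comm = λ {x} {y} → from-yes (∀? λ x → ∀? λ y →
      isTest? x →-dec isTest? y →-dec x ⊗ y ≟ y ⊗ x) x y
  }

e₁₁⊗e₁₂≢e₁₂⊗e₁₁ : e₁₁ ⊗ e₁₂ ≢ e₁₂ ⊗ e₁₁
e₁₁⊗e₁₂≢e₁₂⊗e₁₁ ()

e₁₁⇒𝟎-comm : ∀ x → (e₁₁ ⇒ 𝟎) ⊗ x ≡ x ⊗ (e₁₁ ⇒ 𝟎)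
e₁₁⇒𝟎-comm = from-yes (∀? λ x → (e₁₁ ⇒ 𝟎) ⊗ x ≟ x ⊗ (e₁₁ ⇒ 𝟎))

lemma4 : Σ GKAT λ G → let open GKAT G in
    Σ K λ b → Σ (T b) λ tb → Σ K λ p →
    ((b ⨾ p ≡ p ⨾ b) × ¬ (imp b 𝟘 tb T-𝟘 ⨾ p ≡ p ⨾ imp b 𝟘 tb T-𝟘))
    ⊎ (¬ (b ⨾ p ≡ p ⨾ b) × (imp b 𝟘 tb T-𝟘 ⨾ p ≡ p ⨾ imp b 𝟘 tb T-𝟘))
lemma4 = upperTriangular , e₁₁ , inj₂ (inj₁ refl) , e₁₂ ,
         inj₂ (e₁₁⊗e₁₂≢e₁₂⊗e₁₁ , e₁₁⇒𝟎-comm e₁₂)
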